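{- For every integer $n \ge 1$, the complete graph $K_n$ satisfies $\mathrm{avg}_1(K_n) = 2 - \dfrac{1}{2^n - 1}$.
   Context: Let $G=(V,E)$ be a finite connected graph with a fixed root vertex $v_0\in V$. For $M\in\mathbb{N}$, an $M$-Lipschitz mapping of $G$ is a map $f:V\to\mathbb{Z}$ with $f(v_0)=0$ and $|f(u)-f(v)|\le M$ for every edge $uv\in E$; the (finite) set of these is $\mathcal{L}_M(G)$. The range of $f$ is $\mathrm{rng}(f)=|\{f(v): v\in V\}|$. The average range is $\mathrm{avg}_M(G)=\frac{\sum_{f\in\mathcal{L}_M(G)}\mathrm{rng}(f)}{|\mathcal{L}_M(G)|}$ (for any choice of root). -}

module Defs where

open import Data.Nat as ℕ using (ℕ; zero; suc; _^_; _∸_; NonZero)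
open import Data.Nat.Properties as ℕP using ()
open import Data.Integer as ℤ using (ℤ; +_; ∣_∣)
open import Data.Fin using (Fin)
open import Data.Vec using (Vec; lookup; toList)
open import Data.List using (List; []; _∷_; length; deduplicate; map)
open import Data.Nat.ListAction using (sum)
open import Data.List.Relation.Unary.Unique.Propositional using (Unique)
open import Data.List.Membership.Propositional using (_∈_)
open import Data.Rational as ℚ using (ℚ; _/_)
open import Data.Product using (Σ; _×_)
open import Function.Bundles using (_⇔_)
open import Relation.Binary.PropositionalEquality using (_≡_; _≢_)

record Graph : Set₁ where
  field
    size : ℕ
    Edge : Fin size → Fin size → Set

open Graph public

K : ℕ → Graph
K n = record { size = n ; Edge = λ u v → u ≢ v }

Map : Graph → Set
Map G = Vec ℤ (size G)

IsLipschitz : (G : Graph) → Fin (size G) → ℕ → Map G → Set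
IsLipschitz G v₀ M f =
  (lookup f v₀ ≡ + 0) ×
  (∀ u v → Edge G u v → ∣ lookup f u ℤ.- lookup f v ∣ ℕ.≤ M)

rng : ∀ {n} → Vec ℤ n → ℕ
rng f = length (deduplicate ℤ._≟_ (toList f))

Enumerates : (G : Graph) → Fin (size G) → ℕ → List (Map G) → Set
Enumerates G v₀ M L = Unique L × (∀ f → (f ∈ L) ⇔ IsLipschitz G v₀ M f)

-- arithmetic mean of a list of naturals (0 for the empty list, never used here)
mean : List ℕ → ℚ
mean []         = ℚ.0ℚ
mean xs@(_ ∷ _) = (+ sum xs) / length xs

AvgIs : (G : Graph) → Fin (size G) → ℕ → ℚ → Set
AvgIs G v₀ M q = Σ (List (Map G)) λ L → Enumerates G v₀ M L × (mean (map rng L) ≡ q)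

2^n∸1-nonZero : ∀ n → .{{NonZero n}} → NonZero (2 ^ n ∸ 1)
2^n∸1-nonZero (suc m) = ℕ.>-nonZero (ℕP.m<n⇒0<n∸m (ℕP.*-monoʳ-≤ 2 (ℕP.m^n>0 2 m)))

rhs : (n : ℕ) → .{{NonZero n}} → ℚ
rhs n = (+ 2 / 1) ℚ.- _/_ (+ 1) (2 ^ n ∸ 1) {{2^n∸1-nonZero n}}

module Submission where

-- Since f(v₀) = 0 and any two vertices of Kₙ are adjacent, a 1-Lipschitz map takes its
-- values in {0, 1} or in {0, -1}, and conversely every such map is 1-Lipschitz. Deleting the
-- root, these are the binary vectors of length n - 1 for either sign, the zero vector being
-- shared: 2ⁿ - 1 maps in all, the zero map of range 1 and 2ⁿ - 2 maps of range 2. Their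
-- average range is (2(2ⁿ - 1) - 1) / (2ⁿ - 1) = 2 - 1 / (2ⁿ - 1).

open import Defs
open import Data.Nat using (ℕ; NonZero)
open import Data.Fin using (Fin)

open import Data.Fin as Fin using (zero; suc)
import Data.Fin.Properties as FinP
open import Data.Integer as ℤ using (ℤ; +_; -[1+_]; ∣_∣)
open import Data.Integer.Properties as ℤP using (pos-*; ∣-i∣≡∣i∣)
open import Data.List using (List; []; _∷_; _++_; map; length; deduplicate)
open import Data.List.Properties using (length-map; length-++)
open import Data.List.Membership.Propositional using (_∈_)
open import Data.List.Membership.Propositional.Properties
  using (∈-map⁺; ∈-map⁻; ∈-++⁺ˡ; ∈-++⁺ʳ; ∈-++⁻; deduplicate-∈⇔)
open import Data.List.Membership.Propositional.Properties.WithK using (unique∧set⇒bag)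
open import Data.List.Relation.Binary.BagAndSetEquality using (∼bag⇒↭)
open import Data.List.Relation.Binary.Disjoint.Propositional using (Disjoint)
open import Data.List.Relation.Binary.Permutation.Propositional.Properties using (↭-length)
import Data.List.Relation.Unary.All as ListAll
import Data.List.Relation.Unary.All.Properties as ListAllP
open import Data.List.Relation.Unary.Any using (here; there)
open import Data.List.Relation.Unary.Unique.Propositional using (Unique; []; _∷_)
import Data.List.Relation.Unary.Unique.Propositional.Properties as UniqueP
open import Data.Nat using (zero; suc; _+_; _*_; _∸_; _^_; _≤_; z≤n; s≤s)
open import Data.Nat.ListAction using (sum)
open import Data.Nat.Properties as ℕP using (+-suc; +-identityʳ; +-∸-assoc; *-suc; *-zeroʳ)
open import Data.Nat.Tactic.RingSolver using (solve-∀)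
open import Data.Product using (_×_; _,_; proj₁; proj₂; ∃)
open import Data.Rational as ℚ using (_/_)
open import Data.Rational.Properties using (toℚᵘ-injective; toℚᵘ-fromℚᵘ; toℚᵘ-homo-+; toℚᵘ-homo‿-; /-cong)
import Data.Rational.Unnormalised as ℚᵘ
import Data.Rational.Unnormalised.Properties as ℚᵘP
open import Data.Sum using (_⊎_; inj₁; inj₂)
open import Data.Vec using (Vec; []; _∷_; lookup; replicate; insertAt; removeAt)
open import Data.Vec.Properties using (∷-injectiveˡ; ∷-injectiveʳ; insertAt-lookup; insertAt-removeAt; removeAt-insertAt)
open import Data.Vec.Membership.Propositional using () renaming (_∈_ to _∈ᵥ_)
open import Data.Vec.Membership.Propositional.Properties using (∈-toList⁺; ∈-toList⁻; ∈-lookup)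
open import Data.Vec.Relation.Unary.All as All using (All; []; _∷_)
open import Data.Vec.Relation.Unary.All.Properties using (lookup⁺; lookup⁻)
open import Data.Vec.Relation.Unary.Any using (Any; here; there)
open import Function.Base using (_∘_)
open import Function.Bundles using (_⇔_; mk⇔)
open import Function.Construct.Composition using (_⇔-∘_)
open import Function.Construct.Symmetry using (⇔-sym)
open import Relation.Binary.Definitions using (DecidableEquality)
open import Relation.Binary.PropositionalEquality
open import Relation.Nullary using (yes; no; contradiction)

module _ {a} {A : Set a} (_≟_ : DecidableEquality A) where
  open import Data.List.Relation.Unary.Unique.DecPropositional.Properties _≟_ using (deduplicate-!)

  length-deduplicate : ∀ {xs ys : List A} → Unique ys → (∀ {x} → x ∈ xs ⇔ x ∈ ys) →
                       length (deduplicate _≟_ xs) ≡ length ys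
  length-deduplicate ys! xs≈ys =
    ↭-length (∼bag⇒↭ (unique∧set⇒bag (deduplicate-! _) ys! (xs≈ys ⇔-∘ ⇔-sym (deduplicate-∈⇔ _≟_))))

sum-map-const : ∀ {a} {A : Set a} (g : A → ℕ) {c} {xs : List A} →
                ListAll.All (λ x → g x ≡ c) xs → sum (map g xs) ≡ c * length xs
sum-map-const g {c} ListAll.[] = sym (*-zeroʳ c)
sum-map-const g {c} {_ ∷ xs} (gx≡c ListAll.∷ gxs≡c) =
  trans (cong₂ _+_ gx≡c (sum-map-const g gxs≡c)) (sym (*-suc c (length xs)))

∈-map-∷-++⁻ : ∀ {a} {A : Set a} {k} {x y : A} {xs ys : List (Vec A k)} {v} →
              v ∈ map (x ∷_) xs ++ map (y ∷_) ys →
              (∃ λ w → w ∈ xs × v ≡ x ∷ w) ⊎ (∃ λ w → w ∈ ys × v ≡ y ∷ w)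
∈-map-∷-++⁻ {x = x} {y} {xs} v∈ with ∈-++⁻ (map (x ∷_) xs) v∈
... | inj₁ v∈xs = inj₁ (∈-map⁻ (x ∷_) v∈xs)
... | inj₂ v∈ys = inj₂ (∈-map⁻ (y ∷_) v∈ys)

map-∷-disjoint : ∀ {a} {A : Set a} {k} {x y : A} {xs ys : List (Vec A k)} → x ≢ y →
                 Disjoint (map (x ∷_) xs) (map (y ∷_) ys)
map-∷-disjoint {x = x} {y} x≢y (v∈xs , v∈ys) with ∈-map⁻ (x ∷_) v∈xs | ∈-map⁻ (y ∷_) v∈ys
... | _ , _ , refl | _ , _ , x∷w≡y∷w′ = x≢y (∷-injectiveˡ x∷w≡y∷w′)

module _ {a p} {A : Set a} {P : A → Set p} where

  All-replicate⁺ : ∀ {x} k → P x → All P (replicate k x)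
  All-replicate⁺ zero    px = []
  All-replicate⁺ (suc k) px = px ∷ All-replicate⁺ k px

  All-insertAt⁺ : ∀ {n x} {xs : Vec A n} (i : Fin (suc n)) → P x → All P xs → All P (insertAt xs i x)
  All-insertAt⁺ zero    px pxs        = px ∷ pxs
  All-insertAt⁺ (suc i) px (py ∷ pxs) = py ∷ All-insertAt⁺ i px pxs

  All-removeAt⁺ : ∀ {n} {xs : Vec A (suc n)} (i : Fin (suc n)) → All P xs → All P (removeAt xs i)
  All-removeAt⁺ zero    (px ∷ pxs)      = pxs
  All-removeAt⁺ (suc i) (px ∷ py ∷ pxs) = px ∷ All-removeAt⁺ i (py ∷ pxs)

  Any-insertAt⁺ : ∀ {n x} {xs : Vec A n} (i : Fin (suc n)) → Any P xs → Any P (insertAt xs i x)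
  Any-insertAt⁺ zero    pxs         = there pxs
  Any-insertAt⁺ (suc i) (here px)   = here px
  Any-insertAt⁺ (suc i) (there pxs) = there (Any-insertAt⁺ i pxs)

Binary : ℤ → ℤ → Set
Binary s x = x ≡ + 0 ⊎ x ≡ s

binary-dist : ∀ {s x y} → Binary s x → Binary s y → ∣ x ℤ.- y ∣ ≤ ∣ s ∣
binary-dist     (inj₁ refl) (inj₁ refl) = z≤n
binary-dist {s} (inj₁ refl) (inj₂ refl) = ℕP.≤-reflexive (trans (cong ∣_∣ (ℤP.+-identityˡ (ℤ.- s))) (∣-i∣≡∣i∣ s))
binary-dist {s} (inj₂ refl) (inj₁ refl) = ℕP.≤-reflexive (cong ∣_∣ (ℤP.+-identityʳ s))
binary-dist {s} (inj₂ refl) (inj₂ refl) = subst (_≤ ∣ s ∣) (cong ∣_∣ (sym (ℤP.+-inverseʳ s))) z≤n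

binaries nonzeroBinaries : ℤ → (k : ℕ) → List (Vec ℤ k)
binaries s k = replicate k (+ 0) ∷ nonzeroBinaries s k
nonzeroBinaries s zero    = []
nonzeroBinaries s (suc k) = map (+ 0 ∷_) (nonzeroBinaries s k) ++ map (s ∷_) (binaries s k)

∈-binaries⁻ : ∀ {s k} {w : Vec ℤ k} → w ∈ binaries s k → All (Binary s) w
∈-nonzeroBinaries⁻ : ∀ {s k} {w : Vec ℤ k} → w ∈ nonzeroBinaries s k → All (Binary s) w × s ∈ᵥ w

∈-binaries⁻ {k = k} (here refl) = All-replicate⁺ k (inj₁ refl)
∈-binaries⁻ (there w∈)         = proj₁ (∈-nonzeroBinaries⁻ w∈)

∈-nonzeroBinaries⁻ {s} {suc k} w∈ with ∈-map-∷-++⁻ {x = + 0} {s} {nonzeroBinaries s k} w∈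
... | inj₁ (w , w∈ , refl) = let bin , s∈ = ∈-nonzeroBinaries⁻ w∈ in inj₁ refl ∷ bin , there s∈
... | inj₂ (w , w∈ , refl) = inj₂ refl ∷ ∈-binaries⁻ w∈ , here refl

∈-binaries⁺ : ∀ {s k} {w : Vec ℤ k} → All (Binary s) w → w ∈ binaries s k
∈-binaries⁺ [] = here refl
∈-binaries⁺ (inj₁ refl ∷ bin) with ∈-binaries⁺ bin
... | here refl = here refl
... | there w∈  = there (∈-++⁺ˡ (∈-map⁺ (+ 0 ∷_) w∈))
∈-binaries⁺ {s} (inj₂ refl ∷ bin) = there (∈-++⁺ʳ _ (∈-map⁺ (s ∷_) (∈-binaries⁺ bin)))

binaries-unique : ∀ {s} → s ≢ + 0 → ∀ k → Unique (binaries s k)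
nonzeroBinaries-unique : ∀ {s} → s ≢ + 0 → ∀ k → Unique (nonzeroBinaries s k)

binaries-unique {s} s≢0 k = ListAll.tabulate zeros∉ ∷ nonzeroBinaries-unique s≢0 k
  where
  zeros∉ : ∀ {w} → w ∈ nonzeroBinaries s k → replicate k (+ 0) ≢ w
  zeros∉ w∈ refl = s≢0 (All.lookup (All-replicate⁺ {P = _≡ + 0} k refl) (proj₂ (∈-nonzeroBinaries⁻ w∈)))

nonzeroBinaries-unique s≢0 zero    = []
nonzeroBinaries-unique s≢0 (suc k) = UniqueP.++⁺
  (UniqueP.map⁺ ∷-injectiveʳ (nonzeroBinaries-unique s≢0 k))
  (UniqueP.map⁺ ∷-injectiveʳ (binaries-unique s≢0 k))
  (map-∷-disjoint (s≢0 ∘ sym))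

length-binaries : ∀ s k → length (binaries s k) ≡ 2 ^ k
length-binaries s zero    = refl
length-binaries s (suc k) = begin
  suc (length (map (+ 0 ∷_) (nonzeroBinaries s k) ++ map (s ∷_) (binaries s k)))
    ≡⟨ cong suc (length-++ (map (+ 0 ∷_) (nonzeroBinaries s k))) ⟩
  suc (length (map (+ 0 ∷_) (nonzeroBinaries s k)) + length (map (s ∷_) (binaries s k)))
    ≡⟨ cong₂ (λ a b → suc (a + b)) (length-map (+ 0 ∷_) (nonzeroBinaries s k)) (length-map (s ∷_) (binaries s k)) ⟩
  length (binaries s k) + length (binaries s k)
    ≡⟨ cong (λ a → a + a) (length-binaries s k) ⟩
  2 ^ k + 2 ^ k
    ≡⟨ cong (λ a → 2 ^ k + a) (sym (+-identityʳ (2 ^ k))) ⟩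
  2 ^ suc k ∎
  where open ≡-Reasoning

rootedAt : ∀ {m} → Fin (suc m) → Vec ℤ m → Vec ℤ (suc m)
rootedAt v₀ w = insertAt w v₀ (+ 0)

module _ {m} (v₀ : Fin (suc m)) where

  rootedAt-root : ∀ w → lookup (rootedAt v₀ w) v₀ ≡ + 0
  rootedAt-root w = insertAt-lookup w v₀ (+ 0)

  0∈rootedAt : ∀ w → + 0 ∈ᵥ rootedAt v₀ w
  0∈rootedAt w = subst (_∈ᵥ rootedAt v₀ w) (rootedAt-root w) (∈-lookup v₀ (rootedAt v₀ w))

  rootedAt-injective : ∀ {w w′} → rootedAt v₀ w ≡ rootedAt v₀ w′ → w ≡ w′
  rootedAt-injective {w} {w′} eq = begin
    w                               ≡⟨ removeAt-insertAt w v₀ (+ 0) ⟨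
    removeAt (rootedAt v₀ w) v₀     ≡⟨ cong (λ f → removeAt f v₀) eq ⟩
    removeAt (rootedAt v₀ w′) v₀    ≡⟨ removeAt-insertAt w′ v₀ (+ 0) ⟩
    w′                              ∎
    where open ≡-Reasoning

  rootedAt-removeAt : ∀ {f} → lookup f v₀ ≡ + 0 → rootedAt v₀ (removeAt f v₀) ≡ f
  rootedAt-removeAt {f} f₀≡0 =
    trans (cong (insertAt (removeAt f v₀) v₀) (sym f₀≡0)) (insertAt-removeAt f v₀)

binary-lipschitz : ∀ (G : Graph) {v₀ s} {f : Map G} → lookup f v₀ ≡ + 0 → All (Binary s) f →
                   IsLipschitz G v₀ ∣ s ∣ f
binary-lipschitz G f₀≡0 bin = f₀≡0 , λ u v _ → binary-dist (lookup⁺ bin u) (lookup⁺ bin v)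

unit-ball : ∀ x → ∣ x ℤ.- + 0 ∣ ≤ 1 → x ≡ + 0 ⊎ x ≡ + 1 ⊎ x ≡ -[1+ 0 ]
unit-ball (+ 0)             _         = inj₁ refl
unit-ball (+ 1)             _         = inj₂ (inj₁ refl)
unit-ball (+ suc (suc _))   (s≤s ())
unit-ball -[1+ 0 ]          _         = inj₂ (inj₂ refl)
unit-ball -[1+ suc _ ]      (s≤s ())

module _ {n} {v₀ : Fin n} {f : Vec ℤ n} (lip : IsLipschitz (K n) v₀ 1 f) where

  private
    f₀≡0     = proj₁ lip
    adjacent = proj₂ lip

  lipschitz-K-values : ∀ u → lookup f u ≡ + 0 ⊎ lookup f u ≡ + 1 ⊎ lookup f u ≡ -[1+ 0 ]
  lipschitz-K-values u with u Fin.≟ v₀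
  ... | yes refl = inj₁ f₀≡0
  ... | no u≢v₀  = unit-ball (lookup f u) (subst (λ y → ∣ lookup f u ℤ.- y ∣ ≤ 1) f₀≡0 (adjacent u v₀ u≢v₀))

  lipschitz-K⇒binary : All (Binary (+ 1)) f ⊎ All (Binary -[1+ 0 ]) f
  lipschitz-K⇒binary with FinP.any? (λ j → lookup f j ℤ.≟ + 1)
  ... | yes (j , fj≡1) = inj₁ (lookup⁻ nonnegative)
    where
    nonnegative : ∀ u → Binary (+ 1) (lookup f u)
    nonnegative u with lipschitz-K-values u
    ... | inj₁ fu≡0         = inj₁ fu≡0
    ... | inj₂ (inj₁ fu≡1)  = inj₂ fu≡1
    ... | inj₂ (inj₂ fu≡-1) = contradiction
      (subst₂ (λ x y → ∣ x ℤ.- y ∣ ≤ 1) fu≡-1 fj≡1 (adjacent u j u≢j)) (ℕP.<-irrefl refl)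
      where
      u≢j : u ≢ j
      u≢j refl with () ← trans (sym fu≡-1) fj≡1
  ... | no ∄1 = inj₂ (lookup⁻ nonpositive)
    where
    nonpositive : ∀ u → Binary -[1+ 0 ] (lookup f u)
    nonpositive u with lipschitz-K-values u
    ... | inj₁ fu≡0         = inj₁ fu≡0
    ... | inj₂ (inj₁ fu≡1)  = contradiction (u , fu≡1) ∄1
    ... | inj₂ (inj₂ fu≡-1) = inj₂ fu≡-1

-- The zero map is the common first element of binaries (+ 1) m and binaries -[1+ 0 ] m; it is listed once.
lipschitzMaps : ∀ m → Fin (suc m) → List (Vec ℤ (suc m))
lipschitzMaps m v₀ = map (rootedAt v₀) (binaries (+ 1) m ++ nonzeroBinaries -[1+ 0 ] m)

module _ {m} (v₀ : Fin (suc m)) where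

  lipschitzMaps-unique : Unique (lipschitzMaps m v₀)
  lipschitzMaps-unique = UniqueP.map⁺ (rootedAt-injective v₀)
    (UniqueP.++⁺ (binaries-unique (λ ()) m) (nonzeroBinaries-unique (λ ()) m) disjoint)
    where
    disjoint : Disjoint (binaries (+ 1) m) (nonzeroBinaries -[1+ 0 ] m)
    disjoint (w∈ , w∈′) with All.lookup (∈-binaries⁻ w∈) (proj₂ (∈-nonzeroBinaries⁻ w∈′))
    ... | inj₁ ()
    ... | inj₂ ()

  ∈-lipschitzMaps⇔ : ∀ f → f ∈ lipschitzMaps m v₀ ⇔ IsLipschitz (K (suc m)) v₀ 1 f
  ∈-lipschitzMaps⇔ f = mk⇔ sound complete
    where
    sound : f ∈ lipschitzMaps m v₀ → IsLipschitz (K (suc m)) v₀ 1 f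
    sound f∈ with ∈-map⁻ (rootedAt v₀) f∈
    ... | w , w∈ , refl with ∈-++⁻ (binaries (+ 1) m) w∈
    ...   | inj₁ w∈₊ = binary-lipschitz (K (suc m)) (rootedAt-root v₀ w)
                         (All-insertAt⁺ v₀ (inj₁ refl) (∈-binaries⁻ w∈₊))
    ...   | inj₂ w∈₋ = binary-lipschitz (K (suc m)) (rootedAt-root v₀ w)
                         (All-insertAt⁺ v₀ (inj₁ refl) (proj₁ (∈-nonzeroBinaries⁻ w∈₋)))

    complete : IsLipschitz (K (suc m)) v₀ 1 f → f ∈ lipschitzMaps m v₀
    complete lip = subst (_∈ lipschitzMaps m v₀) (rootedAt-removeAt v₀ (proj₁ lip))
                     (∈-map⁺ (rootedAt v₀) (removeAt∈ (lipschitz-K⇒binary lip)))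
      where
      removeAt∈ : All (Binary (+ 1)) f ⊎ All (Binary -[1+ 0 ]) f →
                  removeAt f v₀ ∈ binaries (+ 1) m ++ nonzeroBinaries -[1+ 0 ] m
      removeAt∈ (inj₁ bin) = ∈-++⁺ˡ (∈-binaries⁺ (All-removeAt⁺ v₀ bin))
      removeAt∈ (inj₂ bin) with ∈-binaries⁺ (All-removeAt⁺ v₀ bin)
      ... | here w≡0  = ∈-++⁺ˡ {xs = binaries (+ 1) m} (here w≡0)
      ... | there w∈ = ∈-++⁺ʳ (binaries (+ 1) m) w∈

rng≡length : ∀ {n} {f : Vec ℤ n} {ys} → Unique ys → (∀ {x} → x ∈ᵥ f ⇔ x ∈ ys) → rng f ≡ length ys
rng≡length ys! f≈ys = length-deduplicate ℤ._≟_ ys! (f≈ys ⇔-∘ mk⇔ ∈-toList⁻ ∈-toList⁺)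

module _ {m} (v₀ : Fin (suc m)) where

  rng-rootedAt-zeros : rng (rootedAt v₀ (replicate m (+ 0))) ≡ 1
  rng-rootedAt-zeros = rng≡length (ListAll.[] ∷ []) (mk⇔ (here ∘ All.lookup zeros) λ { (here refl) → 0∈rootedAt v₀ _ })
    where
    zeros : All (_≡ + 0) (rootedAt v₀ (replicate m (+ 0)))
    zeros = All-insertAt⁺ v₀ refl (All-replicate⁺ m refl)

  rng-rootedAt-nonzeroBinary : ∀ {s w} → s ≢ + 0 → w ∈ nonzeroBinaries s m → rng (rootedAt v₀ w) ≡ 2
  rng-rootedAt-nonzeroBinary {s} {w} s≢0 w∈ =
    rng≡length (((s≢0 ∘ sym) ListAll.∷ ListAll.[]) ∷ ListAll.[] ∷ []) (mk⇔ to from)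
    where
    to : ∀ {x} → x ∈ᵥ rootedAt v₀ w → x ∈ + 0 ∷ s ∷ []
    to x∈ with All.lookup (All-insertAt⁺ v₀ (inj₁ refl) (proj₁ (∈-nonzeroBinaries⁻ w∈))) x∈
    ... | inj₁ x≡0 = here x≡0
    ... | inj₂ x≡s = there (here x≡s)

    from : ∀ {x} → x ∈ + 0 ∷ s ∷ [] → x ∈ᵥ rootedAt v₀ w
    from (here refl)         = 0∈rootedAt v₀ w
    from (there (here refl)) = Any-insertAt⁺ v₀ (proj₂ (∈-nonzeroBinaries⁻ w∈))

  length-lipschitzMaps : length (lipschitzMaps m v₀) ≡ 2 ^ suc m ∸ 1
  length-lipschitzMaps = begin
    length (lipschitzMaps m v₀)
      ≡⟨ length-map (rootedAt v₀) (binaries (+ 1) m ++ nonzeroBinaries -[1+ 0 ] m) ⟩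
    length (binaries (+ 1) m ++ nonzeroBinaries -[1+ 0 ] m)
      ≡⟨ length-++ (binaries (+ 1) m) ⟩
    length (binaries (+ 1) m) + length (nonzeroBinaries -[1+ 0 ] m)
      ≡⟨ +-∸-assoc (length (binaries (+ 1) m)) (s≤s z≤n) ⟨
    length (binaries (+ 1) m) + length (binaries -[1+ 0 ] m) ∸ 1
      ≡⟨ cong₂ (λ a b → a + b ∸ 1) (length-binaries (+ 1) m) (length-binaries -[1+ 0 ] m) ⟩
    2 ^ m + 2 ^ m ∸ 1
      ≡⟨ cong (λ a → 2 ^ m + a ∸ 1) (sym (+-identityʳ (2 ^ m))) ⟩
    2 ^ suc m ∸ 1 ∎
    where open ≡-Reasoning

  sum-rng-lipschitzMaps : sum (map rng (lipschitzMaps m v₀)) ≡ 2 * length (lipschitzMaps m v₀) ∸ 1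
  sum-rng-lipschitzMaps = begin
    rng (rootedAt v₀ (replicate m (+ 0))) + sum (map rng nonzeroMaps)
      ≡⟨ cong₂ _+_ rng-rootedAt-zeros (sum-map-const rng (ListAllP.map⁺ (ListAllP.++⁺
           (ListAll.tabulate (rng-rootedAt-nonzeroBinary (λ ())))
           (ListAll.tabulate (rng-rootedAt-nonzeroBinary (λ ())))))) ⟩
    1 + 2 * length nonzeroMaps
      ≡⟨ +-suc (length nonzeroMaps) (length nonzeroMaps + 0) ⟨
    2 * suc (length nonzeroMaps) ∸ 1 ∎
    where
    open ≡-Reasoning
    nonzeroMaps = map (rootedAt v₀) (nonzeroBinaries (+ 1) m ++ nonzeroBinaries -[1+ 0 ] m)

two-minus-reciprocal : ∀ d .{{_ : NonZero d}} → + 2 / 1 ℚ.- + 1 / d ≡ + (2 * d ∸ 1) / d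
two-minus-reciprocal (suc k) = toℚᵘ-injective (begin
  ℚ.toℚᵘ (+ 2 / 1 ℚ.- + 1 / suc k)
    ≈⟨ toℚᵘ-homo-+ (+ 2 / 1) (ℚ.- (+ 1 / suc k)) ⟩
  ℚᵘ.mkℚᵘ (+ 2) 0 ℚᵘ.+ ℚ.toℚᵘ (ℚ.- (+ 1 / suc k))
    ≈⟨ ℚᵘP.+-congʳ _ (ℚᵘP.≃-trans (toℚᵘ-homo‿- (+ 1 / suc k)) (ℚᵘP.-‿cong (toℚᵘ-fromℚᵘ (ℚᵘ.mkℚᵘ (+ 1) k)))) ⟩
  ℚᵘ.mkℚᵘ (+ 2) 0 ℚᵘ.- ℚᵘ.mkℚᵘ (+ 1) k
    ≈⟨ ℚᵘ.*≡* (trans (sym (pos-* (k + 1 * suc k) (suc k)))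
                (trans (cong +_ (cross-multiplied k)) (pos-* (2 * suc k ∸ 1) (suc (k + 0 * suc k))))) ⟩
  ℚᵘ.mkℚᵘ (+ (2 * suc k ∸ 1)) k
    ≈⟨ toℚᵘ-fromℚᵘ _ ⟨
  ℚ.toℚᵘ (+ (2 * suc k ∸ 1) / suc k) ∎)
  where
  open ℚᵘP.≃-Reasoning
  -- both sides as the ℚᵘ arithmetic leaves them in normal form
  cross-multiplied : ∀ k → (k + 1 * suc k) * suc k ≡ (k + suc (k + 0)) * suc (k + 0 * suc k)
  cross-multiplied = solve-∀

theorem1 : (n : ℕ) → .{{_ : NonZero n}} → (v₀ : Fin n) → AvgIs (K n) v₀ 1 (rhs n)
theorem1 (suc m) v₀ = lipschitzMaps m v₀ , (lipschitzMaps-unique v₀ , ∈-lipschitzMaps⇔ v₀) , average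
  where
  open ≡-Reasoning
  L = lipschitzMaps m v₀
  d = 2 ^ suc m ∸ 1
  instance _ = 2^n∸1-nonZero (suc m)

  average : mean (map rng L) ≡ rhs (suc m)
  average = begin
    + sum (map rng L) / length (map rng L)
      ≡⟨ /-cong (cong +_ (trans (sum-rng-lipschitzMaps v₀) (cong (λ ℓ → 2 * ℓ ∸ 1) (length-lipschitzMaps v₀))))
                (trans (length-map rng L) (length-lipschitzMaps v₀)) ⟩
    + (2 * d ∸ 1) / d
      ≡⟨ two-minus-reciprocal d ⟨
    rhs (suc m) ∎
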